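{- Let $q\in\mathbb{Q}\cap\mathbb{Z}_2$ and let $a,k,b,v\in\mathbb{N}$ with $a<2^k$, $b<2^v$ and $q=a+2^k\bar{b}_{v,\infty}$. Suppose the binary digit expansion of $\Phi(q)$ is $r_0r_1\cdots r_{u-1}\overline{r_ur_{u+1}\cdots r_{u+p-1}}$ (i.e. $r_{i+p}=r_i$ for all $i\geq u$), and choose $t\in\mathbb{N}$ with $k+tv\geq u$. Then for every positive integer $H$, $$R_{k+tv}\left(\Phi\left(L_{k+tv}(q)\right)\right)\equiv R_{k+(t+p2^H)v}\left(\Phi\left(L_{k+(t+p2^H)v}(q)\right)\right)\pmod{2^{H+2}}.$$
   Context: $\mathbb{Z}_2$ is the ring of $2$-adic integers; $\mathbb{N}=\{0,1,2,\dots\}$. Every $x\in\mathbb{Z}_2$ has a unique expansion $x=\sum_{i\geq0}d_i2^i$ with $d_i\in\{0,1\}$, written $x=d_0d_1d_2\cdots$; an overline denotes a block of digits repeated forever. The map $\Phi:\mathbb{Z}_2\to\mathbb{Z}_2$ is defined as follows: if $x=\sum_i 2^{e_i}$ with $0\leq e_0<e_1<\cdots$ (finite or infinite sum; $x=0$ is the empty sum), then $\Phi(x)=-\sum_i 2^{e_i}3^{ -i}$ ($\Phi(0)=0$). For $x\in\mathbb{Z}_2$ and $c\in\mathbb{N}$, $L_c(x)$ is the least natural number congruent to $x$ modulo $2^c$, and $R_c(x)=d_cd_{c+1}\cdots=\sum_{i\geq0}d_{c+i}2^i$. For $b,v,t\in\mathbb{N}$, $\bar{b}_{v,t}=b\sum_{i=0}^{t-1}2^{vi}$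 and $\bar{b}_{v,\infty}=b\sum_{i=0}^{\infty}2^{vi}$. -}

module Defs where

open import Data.Bool using (Bool; true; false; if_then_else_)
open import Data.Nat using (ℕ; zero; suc; _+_; _*_; _^_; _<_; _≡ᵇ_; NonZero)
import Data.Nat as N
open import Data.Nat.Properties using (m^n≢0)
open import Data.Integer as Z using (ℤ; +_)
import Data.Integer.DivMod as ZD
open import Data.Rational as Q using (ℚ; ↥_; ↧_)
open import Data.List using (List; []; _∷_; filter; upTo; zip; map; length)
open import Relation.Binary.PropositionalEquality using (_≡_)
open import Data.Product using (_×_; _,_)
import Data.Bool as B

bit : ℕ → ℕ → Bool
bit n i = ((n N./ (2 ^ i)) {{m^n≢0 2 i}} N.% 2) ≡ᵇ 1

Σ< : ℕ → (ℕ → ℕ) → ℕ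
Σ< zero    f = 0
Σ< (suc c) f = Σ< c f + f c

-- bounded search: the least y < n with P y, or n if there is none
least : ℕ → (ℕ → Bool) → ℕ
least zero    P = zero
least (suc n) P = if P 0 then 0 else suc (least n (λ y → P (suc y)))

-- 2-adic integers, represented by their binary digit expansions
-- x = d₀ d₁ d₂ ⋯  (x = Σ dᵢ 2ⁱ)

ℤ₂ : Set
ℤ₂ = ℕ → Bool

toℕ : Bool → ℕ
toℕ true  = 1
toℕ false = 0

fromℕ : ℕ → ℤ₂
fromℕ n i = bit n i

-- L_c(x): least natural number congruent to x mod 2^c
L : ℕ → ℤ₂ → ℕ
L c x = Σ< c (λ i → toℕ (x i) * 2 ^ i)

R : ℕ → ℤ₂ → ℤ₂
R c x i = x (c + i)

_≡[mod2^_]_ : ℤ₂ → ℕ → ℤ₂ → Set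
x ≡[mod2^ m ] y = L m x ≡ L m y

-- A rational with odd denominator lies in ℤ₂.  Its residue mod 2^m is
-- the least y < 2^m with 2^m ∣ (den·y − num), i.e. y ≡ num/den (mod 2^m).
residue : ℕ → ℚ → ℕ
residue m x = least (2 ^ m)
  (λ y → Z._%ℕ_ (↧ x Z.* + y Z.- ↥ x) (2 ^ m) {{m^n≢0 2 m}} ≡ᵇ 0)

ℚ→ℤ₂ : ℚ → ℤ₂
ℚ→ℤ₂ x i = bit (residue (suc i) x) i

-- exponents e₀ < e₁ < ⋯ of the binary expansion n = Σ 2^{eᵢ}
-- (all exponents of n are < n + 1)
exps : ℕ → List ℕ
exps n = filter (λ i → bit n i B.≟ true) (upTo (suc n))

ΦΣ : List (ℕ × ℕ) → ℚ
ΦΣ [] = Q.0ℚ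
ΦΣ ((i , e) ∷ rest) = ((+ (2 ^ e)) Q./ (3 ^ i)) {{m^n≢0 3 i}} Q.+ ΦΣ rest

Φℕ : ℕ → ℚ
Φℕ n = Q.- ΦΣ (zip (upTo (length (exps n))) (exps n))

-- Φ on ℤ₂: the infinite sum − Σᵢ 2^{eᵢ} 3^{−i} is the 2-adic limit of
-- its partial sums Φ(L_c x); digit j of the limit is digit j of Φ(L_{j+1} x)
-- (terms with eᵢ ≥ j+1 are divisible by 2^{j+1}).
Φ : ℤ₂ → ℤ₂
Φ x j = ℚ→ℤ₂ (Φℕ (L (suc j) x)) j

bbar : ℕ → ℕ → ℕ → ℕ
bbar b v t = b * Σ< t (λ i → 2 ^ (v * i))

-- the 2-adic integer a + 2^k b̄_{v,∞}: its digit j is digit j of the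
-- partial sum a + 2^k b̄_{v,j+1} (later terms are divisible by 2^{k+v(j+1)}).
aBbar : ℕ → ℕ → ℕ → ℕ → ℤ₂
aBbar a k b v j = bit (a + 2 ^ k * bbar b v (suc j)) j

-- Write nₜ = a + 2ᵏ b̄_{v,t}, the truncation L_{k+tv}(q). For a natural number n,
-- Φ(n) = −Ψ(n) / 3^{s(n)} with s(n) its number of binary ones, and appending blocks,
-- n_{t+d} = nₜ + 2^{k+tv} b̄_{v,d}, gives Φ(n_{t+d}) = Φ(nₜ) − 2^{k+tv} W_d / 3^{s(n_{t+d})} with
-- W_d = Ψ(b̄_{v,d}). So Φ(n_{t+d}) shares the first k+tv digits of Φ(nₜ), and above them
-- R_{k+tv} Φ(n_{t+d}) ≡ R_{k+tv} Φ(nₜ) − W_d / 3^{s(n_{t+d})}. Compare nₜ and n_{t′}, t′ = t + p 2^H,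
-- with n_T, T = t′ + H + 2: below k+Tv the digits of Φ(n_T) are those of Φ(q), so by periodicity the
-- H+2 digits of Φ(n_T) above k+tv and above k+t′v coincide. The two congruences modulo 2^{H+2} then
-- differ only through W_{p2^H+H+2} ≡ W_{H+2}, which holds because 3^{2^H} ≡ 1 (mod 2^{H+2}) and v ≥ 1.

module Submission where

open import Defs
open import Data.Bool using (Bool; true; false)
open import Function using (_∘_)
open import Data.Product using (_×_; _,_; proj₁; proj₂; ∃)
open import Relation.Binary.PropositionalEquality
open import Data.Empty using (⊥-elim)
open import Relation.Nullary using (¬_)
open import Data.Sum using (_⊎_; inj₁; inj₂)

module BinaryDigits where

  open import Data.Nat
  open import Data.Nat.Properties
  open import Data.Nat.DivMod
  open import Data.Nat.Tactic.RingSolver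
  open import Relation.Binary.Definitions using (tri<; tri≈; tri>)

  infixl 7 _%2^_ _/2^_

  _%2^_ : ℕ → ℕ → ℕ
  n %2^ m = (n % 2 ^ m) {{m^n≢0 2 m}}

  _/2^_ : ℕ → ℕ → ℕ
  n /2^ m = (n / 2 ^ m) {{m^n≢0 2 m}}

  private
    lower-quotient-smaller : ∀ d {r q} r′ {q′} → r < d → q < q′ → r + q * d < r′ + q′ * d
    lower-quotient-smaller d {r} {q} r′ {q′} r<d q<q′ = begin-strict
      r + q * d   <⟨ +-monoˡ-< (q * d) r<d ⟩
      suc q * d   ≤⟨ *-monoˡ-≤ d q<q′ ⟩
      q′ * d      ≤⟨ m≤n+m (q′ * d) r′ ⟩
      r′ + q′ * d ∎
      where open ≤-Reasoning

  quotient-unique : ∀ d {r q r′ q′} → r < d → r′ < d → r + q * d ≡ r′ + q′ * d → q ≡ q′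
  quotient-unique d {r} {q} {r′} {q′} r<d r′<d eq with <-cmp q q′
  ... | tri≈ _ q≡q′ _ = q≡q′
  ... | tri< q<q′ _ _ = ⊥-elim (<-irrefl eq (lower-quotient-smaller d r′ r<d q<q′))
  ... | tri> _ _ q′<q = ⊥-elim (<-irrefl (sym eq) (lower-quotient-smaller d r r′<d q′<q))

  /-%-unique : ∀ n d .{{_ : NonZero d}} r q → r < d → n ≡ r + q * d → n / d ≡ q × n % d ≡ r
  /-%-unique n d r q r<d n≡ = /≡q , +-cancelʳ-≡ (q * d) (n % d) r (begin
      n % d + q * d       ≡⟨ cong (λ z → n % d + z * d) /≡q ⟨
      n % d + n / d * d   ≡⟨ m≡m%n+[m/n]*n n d ⟨
      n                   ≡⟨ n≡ ⟩
      r + q * d           ∎)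
    where
    open ≡-Reasoning
    /≡q : n / d ≡ q
    /≡q = quotient-unique d (m%n<n n d) r<d (trans (sym (m≡m%n+[m/n]*n n d)) n≡)

  toℕ≤1 : ∀ b → toℕ b ≤ 1
  toℕ≤1 true  = s≤s z≤n
  toℕ≤1 false = z≤n

  toℕ-bit : ∀ n i → toℕ (bit n i) ≡ (n /2^ i) % 2
  toℕ-bit n i with (n /2^ i) % 2 | m%n<n (n /2^ i) 2
  ... | 0 | _ = refl
  ... | 1 | _ = refl
  ... | 2+ _ | s≤s (s≤s ())

  n<2^[1+n] : ∀ n → n < 2 ^ suc n
  n<2^[1+n] zero    = s≤s z≤n
  n<2^[1+n] (suc n) = +-mono-≤ (m^n>0 2 (suc n)) (subst (suc n ≤_) (sym (+-identityʳ (2 ^ suc n))) (n<2^[1+n] n))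

  n%2^m<2^m : ∀ n m → n %2^ m < 2 ^ m
  n%2^m<2^m n m = m%n<n n (2 ^ m) {{m^n≢0 2 m}}

  n≡n%2^m+[n/2^m]*2^m : ∀ n m → n ≡ n %2^ m + n /2^ m * 2 ^ m
  n≡n%2^m+[n/2^m]*2^m n m = m≡m%n+[m/n]*n n (2 ^ m) {{m^n≢0 2 m}}

  /2^-unique : ∀ n m r q → r < 2 ^ m → n ≡ r + q * 2 ^ m → n /2^ m ≡ q
  /2^-unique n m r q r< n≡ = proj₁ (/-%-unique n (2 ^ m) {{m^n≢0 2 m}} r q r< n≡)

  %2^-unique : ∀ n m r q → r < 2 ^ m → n ≡ r + q * 2 ^ m → n %2^ m ≡ r
  %2^-unique n m r q r< n≡ = proj₂ (/-%-unique n (2 ^ m) {{m^n≢0 2 m}} r q r< n≡)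

  %2^-suc : ∀ n m → n %2^ suc m ≡ n %2^ m + toℕ (bit n m) * 2 ^ m
  %2^-suc n m = %2^-unique n (suc m) _ (n /2^ m / 2) r< (begin
      n                               ≡⟨ n≡n%2^m+[n/2^m]*2^m n m ⟩
      n %2^ m + Q * 2 ^ m             ≡⟨ cong (λ z → n %2^ m + z * 2 ^ m) (m≡m%n+[m/n]*n Q 2) ⟩
      n %2^ m + (Q % 2 + Q / 2 * 2) * 2 ^ m
        ≡⟨ cong (λ z → n %2^ m + (z + Q / 2 * 2) * 2 ^ m) (toℕ-bit n m) ⟨
      n %2^ m + (toℕ (bit n m) + Q / 2 * 2) * 2 ^ m
        ≡⟨ rearrange (n %2^ m) (toℕ (bit n m)) (Q / 2) (2 ^ m) ⟩
      n %2^ m + toℕ (bit n m) * 2 ^ m + Q / 2 * (2 * 2 ^ m) ∎)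
    where
    open ≡-Reasoning
    Q = n /2^ m
    rearrange : ∀ a b c p → a + (b + c * 2) * p ≡ a + b * p + c * (2 * p)
    rearrange = solve-∀
    r< : n %2^ m + toℕ (bit n m) * 2 ^ m < 2 ^ suc m
    r< = +-mono-<-≤ (n%2^m<2^m n m) (*-monoˡ-≤ (2 ^ m) (toℕ≤1 (bit n m)))

  bit-< : ∀ n i → n < 2 ^ i → bit n i ≡ false
  bit-< n i n< rewrite m<n⇒m/n≡0 {n} {2 ^ i} {{m^n≢0 2 i}} n< = refl

  bit-+-low : ∀ x y {m i} → i < m → bit (x + 2 ^ m * y) i ≡ bit x i
  bit-+-low x y {m} {i} i<m with m≤n⇒∃[o]m+o≡n i<m
  ... | r , refl = cong (_≡ᵇ 1) (trans (cong (_% 2) quotient) ([m+kn]%n≡m%n (x /2^ i) (2 ^ r * y) 2))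
    where
    open ≡-Reasoning
    rearrange : ∀ a b p q y → a + b * p + p * (2 * q) * y ≡ a + (b + q * y * 2) * p
    rearrange = solve-∀
    quotient : (x + 2 ^ (suc i + r) * y) /2^ i ≡ x /2^ i + 2 ^ r * y * 2
    quotient = /2^-unique _ i (x %2^ i) _ (n%2^m<2^m x i) (begin
      x + 2 ^ (suc i + r) * y
        ≡⟨ cong₂ (λ a b → a + 2 ^ b * y) (n≡n%2^m+[n/2^m]*2^m x i) (sym (+-suc i r)) ⟩
      x %2^ i + x /2^ i * 2 ^ i + 2 ^ (i + suc r) * y
        ≡⟨ cong (λ z → x %2^ i + x /2^ i * 2 ^ i + z * y) (^-distribˡ-+-* 2 i (suc r)) ⟩
      x %2^ i + x /2^ i * 2 ^ i + 2 ^ i * (2 * 2 ^ r) * y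
        ≡⟨ rearrange (x %2^ i) (x /2^ i) (2 ^ i) (2 ^ r) y ⟩
      x %2^ i + (x /2^ i + 2 ^ r * y * 2) * 2 ^ i         ∎)

  +2^*<2^+ : ∀ {x y} m i → x < 2 ^ m → y < 2 ^ i → x + 2 ^ m * y < 2 ^ (m + i)
  +2^*<2^+ {x} {y} m i x< y< = begin-strict
    x + 2 ^ m * y   <⟨ +-monoˡ-< (2 ^ m * y) x< ⟩
    2 ^ m + 2 ^ m * y ≡⟨ *-suc (2 ^ m) y ⟨
    2 ^ m * suc y   ≤⟨ *-monoʳ-≤ (2 ^ m) y< ⟩
    2 ^ m * 2 ^ i   ≡⟨ ^-distribˡ-+-* 2 m i ⟨
    2 ^ (m + i)     ∎
    where open ≤-Reasoning

  bit-+-high : ∀ x y m i → x < 2 ^ m → bit (x + 2 ^ m * y) (m + i) ≡ bit y i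
  bit-+-high x y m i x< = cong (λ z → z % 2 ≡ᵇ 1) (/2^-unique _ (m + i) _ (y /2^ i)
    (+2^*<2^+ m i x< (n%2^m<2^m y i)) (begin
      x + 2 ^ m * y                                ≡⟨ cong (λ z → x + 2 ^ m * z) (n≡n%2^m+[n/2^m]*2^m y i) ⟩
      x + 2 ^ m * (y %2^ i + y /2^ i * 2 ^ i)      ≡⟨ rearrange x (2 ^ m) (y %2^ i) (y /2^ i) (2 ^ i) ⟩
      x + 2 ^ m * (y %2^ i) + y /2^ i * (2 ^ m * 2 ^ i)
        ≡⟨ cong (λ z → x + 2 ^ m * (y %2^ i) + y /2^ i * z) (^-distribˡ-+-* 2 m i) ⟨
      x + 2 ^ m * (y %2^ i) + y /2^ i * 2 ^ (m + i)  ∎))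
    where
    open ≡-Reasoning
    rearrange : ∀ x p c d q → x + p * (c + d * q) ≡ x + p * c + d * (p * q)
    rearrange = solve-∀

  Σ<-cong : ∀ m {f g} → (∀ {i} → i < m → f i ≡ g i) → Σ< m f ≡ Σ< m g
  Σ<-cong zero    f≗g = refl
  Σ<-cong (suc m) f≗g = cong₂ _+_ (Σ<-cong m (λ i<m → f≗g (m<n⇒m<1+n i<m))) (f≗g (n<1+n m))

  L-cong : ∀ m {x y : ℤ₂} → (∀ {i} → i < m → x i ≡ y i) → L m x ≡ L m y
  L-cong m x≗y = Σ<-cong m (λ {i} i<m → cong (λ d → toℕ d * 2 ^ i) (x≗y i<m))

  L<2^ : ∀ m (x : ℤ₂) → L m x < 2 ^ m
  L<2^ zero    x = s≤s z≤n
  L<2^ (suc m) x = +-mono-<-≤ (L<2^ m x) (*-monoˡ-≤ (2 ^ m) (toℕ≤1 (x m)))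

  L-+ : ∀ c h (x : ℤ₂) → L (c + h) x ≡ L c x + 2 ^ c * L h (R c x)
  L-+ c zero    x rewrite +-identityʳ c | *-zeroʳ (2 ^ c) = sym (+-identityʳ (L c x))
  L-+ c (suc h) x rewrite +-suc c h | L-+ c h x | ^-distribˡ-+-* 2 c h =
    rearrange (L c x) (2 ^ c) (L h (R c x)) (toℕ (x (c + h))) (2 ^ h)
    where
    rearrange : ∀ a p l b q → a + p * l + b * (p * q) ≡ a + p * (l + b * q)
    rearrange = solve-∀

  L-fromℕ : ∀ m n → L m (fromℕ n) ≡ n %2^ m
  L-fromℕ zero    n = sym (%2^-unique n 0 0 n (s≤s z≤n) (sym (*-identityʳ n)))
  L-fromℕ (suc m) n = trans (cong (_+ toℕ (bit n m) * 2 ^ m) (L-fromℕ m n)) (sym (%2^-suc n m))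

module OddPowers where

  open import Data.Nat
  open import Data.Nat.Properties
  open import Data.Nat.Tactic.RingSolver

  infix 4 _≡1[mod_]
  _≡1[mod_] : ℕ → ℕ → Set
  x ≡1[mod M ] = ∃ λ w → x ≡ 1 + w * M

  Odd : ℕ → Set
  Odd x = x ≡1[mod 2 ]

  *-≡1[mod] : ∀ {x y M} → x ≡1[mod M ] → y ≡1[mod M ] → x * y ≡1[mod M ]
  *-≡1[mod] {M = M} (w , refl) (w′ , refl) = w + w′ + w * w′ * M , expand w w′ M
    where
    expand : ∀ w w′ M → (1 + w * M) * (1 + w′ * M) ≡ 1 + (w + w′ + w * w′ * M) * M
    expand = solve-∀

  ^-≡1[mod] : ∀ {x M} → x ≡1[mod M ] → ∀ n → x ^ n ≡1[mod M ]
  ^-≡1[mod] x≡1 zero    = 0 , refl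
  ^-≡1[mod] x≡1 (suc n) = *-≡1[mod] x≡1 (^-≡1[mod] x≡1 n)

  odd-3^ : ∀ s → Odd (3 ^ s)
  odd-3^ = ^-≡1[mod] (1 , refl)

  even⊎odd : ∀ n → (∃ λ s → n ≡ s * 2) ⊎ Odd n
  even⊎odd zero    = inj₁ (0 , refl)
  even⊎odd (suc n) with even⊎odd n
  ... | inj₁ (s , refl) = inj₂ (s , refl)
  ... | inj₂ (s , refl) = inj₁ (suc s , refl)

  *suc-even : ∀ r → ∃ λ s → r * suc r ≡ s * 2
  *suc-even zero    = 0 , refl
  *suc-even (suc r) with *suc-even r
  ... | s , eq = s + suc r , (begin
      suc r * suc (suc r)   ≡⟨ expand r ⟩
      r * suc r + suc r * 2 ≡⟨ cong (_+ suc r * 2) eq ⟩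
      s * 2 + suc r * 2     ≡⟨ *-distribʳ-+ 2 s (suc r) ⟨
      (s + suc r) * 2       ∎)
    where
    open ≡-Reasoning
    expand : ∀ r → suc r * suc (suc r) ≡ r * suc r + suc r * 2
    expand = solve-∀

  odd^2^suc≡1 : ∀ {a} → Odd a → ∀ H → a ^ 2 ^ suc H ≡1[mod 2 ^ (H + 3) ]
  odd^2^suc≡1 (r , refl) zero with *suc-even r
  ... | s , eq = s , (begin
      (1 + r * 2) ^ 2        ≡⟨ expand r ⟩
      1 + r * suc r * 4      ≡⟨ cong (λ z → 1 + z * 4) eq ⟩
      1 + s * 2 * 4          ≡⟨ cong suc (*-assoc s 2 4) ⟩
      1 + s * 8              ∎)
    where
    open ≡-Reasoning
    expand : ∀ r → (1 + r * 2) * ((1 + r * 2) * 1) ≡ 1 + r * suc r * 4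
    expand = solve-∀
  odd^2^suc≡1 {a} odd (suc H) with odd^2^suc≡1 odd H
  ... | w , eq = w + w * w * 2 ^ (H + 2) , (begin
      a ^ 2 ^ suc (suc H)                 ≡⟨ cong (a ^_) (*-comm 2 (2 ^ suc H)) ⟩
      a ^ (2 ^ suc H * 2)                 ≡⟨ ^-*-assoc a (2 ^ suc H) 2 ⟨
      (a ^ 2 ^ suc H) ^ 2                 ≡⟨ cong (_^ 2) eq ⟩
      (1 + w * 2 ^ (H + 3)) ^ 2           ≡⟨ cong (λ z → (1 + w * z) ^ 2) 2^[H+3] ⟩
      (1 + w * (2 * 2 ^ (H + 2))) ^ 2     ≡⟨ expand w (2 ^ (H + 2)) ⟩
      1 + (w + w * w * 2 ^ (H + 2)) * (2 * (2 * 2 ^ (H + 2)))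
                                          ≡⟨ cong (λ z → 1 + (w + w * w * 2 ^ (H + 2)) * (2 * z)) 2^[H+3] ⟨
      1 + (w + w * w * 2 ^ (H + 2)) * 2 ^ (suc H + 3) ∎)
    where
    open ≡-Reasoning
    2^[H+3] : 2 ^ (H + 3) ≡ 2 * 2 ^ (H + 2)
    2^[H+3] = cong (2 ^_) (+-suc H 2)
    expand : ∀ w q → (1 + w * (2 * q)) * ((1 + w * (2 * q)) * 1) ≡ 1 + (w + w * w * q) * (2 * (2 * q))
    expand = solve-∀

  odd-inverse : ∀ {a} → Odd a → ∀ m → ∃ λ K → a * K ≡1[mod 2 ^ m ]
  odd-inverse {a} odd m with odd^2^suc≡1 odd m
  ... | w , eq = a ^ (2 ^ suc m ∸ 1) , w * 8 , (begin
      a * a ^ (2 ^ suc m ∸ 1) ≡⟨ cong (a ^_) (m+[n∸m]≡n (m^n>0 2 (suc m))) ⟩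
      a ^ 2 ^ suc m           ≡⟨ eq ⟩
      1 + w * 2 ^ (m + 3)     ≡⟨ cong (λ z → 1 + w * z) (^-distribˡ-+-* 2 m 3) ⟩
      1 + w * (2 ^ m * 8)     ≡⟨ cong suc (trans (cong (w *_) (*-comm (2 ^ m) 8)) (sym (*-assoc w 8 (2 ^ m)))) ⟩
      1 + w * 8 * 2 ^ m       ∎)
    where open ≡-Reasoning

  3^2^H≡1 : ∀ H → 1 ≤ H → 3 ^ 2 ^ H ≡1[mod 2 ^ (H + 2) ]
  3^2^H≡1 (suc H) _ with odd^2^suc≡1 (odd-3^ 1) H
  ... | w , eq = w , trans eq (cong (λ e → 1 + w * 2 ^ e) (+-suc H 2))

module Exponents where

  open BinaryDigits
  import Data.Bool as B
  open import Data.Nat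
  open import Data.Nat.Properties
  open import Data.Nat.Tactic.RingSolver
  open import Data.List
  open import Data.List.Properties using (filter-++; map-applyUpTo; ++-identityʳ; length-++; length-map)
  open import Data.List.Relation.Unary.All using (All; []; _∷_)
  open import Data.List.Relation.Unary.All.Properties using (applyUpTo⁺₁; applyUpTo⁺₂; map⁺)
  open import Function using (id)
  open import Relation.Nullary.Decidable using (T?)

  module _ {A : Set} where

    filterᵇ-cong : ∀ {f g : A → Bool} {xs} → All (λ x → f x ≡ g x) xs → filterᵇ f xs ≡ filterᵇ g xs
    filterᵇ-cong [] = refl
    filterᵇ-cong {f} {g} {x ∷ _} (fx≡gx ∷ rest) with f x | g x | fx≡gx
    ... | true  | .true  | refl = cong (x ∷_) (filterᵇ-cong rest)
    ... | false | .false | refl = filterᵇ-cong rest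

    filterᵇ-none : ∀ {f : A → Bool} {xs} → All (λ x → f x ≡ false) xs → filterᵇ f xs ≡ []
    filterᵇ-none [] = refl
    filterᵇ-none (fx≡false ∷ rest) rewrite fx≡false = filterᵇ-none rest

    filterᵇ-map : ∀ (f : A → Bool) (g : A → A) xs → filterᵇ f (map g xs) ≡ map g (filterᵇ (f ∘ g) xs)
    filterᵇ-map f g [] = refl
    filterᵇ-map f g (x ∷ xs) with f (g x)
    ... | true  = cong (g x ∷_) (filterᵇ-map f g xs)
    ... | false = filterᵇ-map f g xs

    filter≟true≡filterᵇ : ∀ (f : A → Bool) xs → filter (λ x → f x B.≟ true) xs ≡ filterᵇ f xs
    filter≟true≡filterᵇ f [] = refl
    filter≟true≡filterᵇ f (x ∷ xs) with f x
    ... | true  = cong (x ∷_) (filter≟true≡filterᵇ f xs)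
    ... | false = filter≟true≡filterᵇ f xs

  applyUpTo-+ : ∀ {A : Set} (f : ℕ → A) m n → applyUpTo f (m + n) ≡ applyUpTo f m ++ applyUpTo (f ∘ (m +_)) n
  applyUpTo-+ f zero    n = refl
  applyUpTo-+ f (suc m) n = cong (f 0 ∷_) (applyUpTo-+ (f ∘ suc) m n)

  upTo-+ : ∀ m n → upTo (m + n) ≡ upTo m ++ map (m +_) (upTo n)
  upTo-+ m n = trans (applyUpTo-+ id m n) (cong (upTo m ++_) (sym (map-applyUpTo id (m +_) n)))

  onesBelow : ℕ → ℕ → List ℕ
  onesBelow N n = filterᵇ (bit n) (upTo N)

  onesBelow-+ : ∀ {n} N d → n < 2 ^ N → onesBelow (N + d) n ≡ onesBelow N n
  onesBelow-+ {n} N d n< = begin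
    filterᵇ (bit n) (upTo (N + d))                                    ≡⟨ cong (filterᵇ (bit n)) (upTo-+ N d) ⟩
    filterᵇ (bit n) (upTo N ++ map (N +_) (upTo d))                  ≡⟨ filter-++ (T? ∘ bit n) (upTo N) _ ⟩
    onesBelow N n ++ filterᵇ (bit n) (map (N +_) (upTo d))           ≡⟨ cong (onesBelow N n ++_) (filterᵇ-none high-digits) ⟩
    onesBelow N n ++ []                                               ≡⟨ ++-identityʳ _ ⟩
    onesBelow N n                                                     ∎
    where
    open ≡-Reasoning
    high-digits : All (λ i → bit n i ≡ false) (map (N +_) (upTo d))
    high-digits = map⁺ (applyUpTo⁺₂ id d (λ i → bit-< n (N + i) (<-≤-trans n< (^-monoʳ-≤ 2 (m≤m+n N i)))))

  exps-onesBelow : ∀ {n} N → n < 2 ^ N → exps n ≡ onesBelow N n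
  exps-onesBelow {n} N n< = begin
    exps n                   ≡⟨ filter≟true≡filterᵇ (bit n) (upTo (suc n)) ⟩
    onesBelow (suc n) n      ≡⟨ onesBelow-+ (suc n) N (n<2^[1+n] n) ⟨
    onesBelow (suc n + N) n  ≡⟨ cong (λ M → onesBelow M n) (+-comm (suc n) N) ⟩
    onesBelow (N + suc n) n  ≡⟨ onesBelow-+ N (suc n) n< ⟩
    onesBelow N n            ∎
    where open ≡-Reasoning

  exps-+ : ∀ {x} m y → x < 2 ^ m → exps (x + 2 ^ m * y) ≡ exps x ++ map (m +_) (exps y)
  exps-+ {x} m y x< = begin
    exps X
      ≡⟨ exps-onesBelow (m + suc y) (+2^*<2^+ m (suc y) x< (n<2^[1+n] y)) ⟩
    filterᵇ (bit X) (upTo (m + suc y))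
      ≡⟨ cong (filterᵇ (bit X)) (upTo-+ m (suc y)) ⟩
    filterᵇ (bit X) (upTo m ++ map (m +_) (upTo (suc y)))
      ≡⟨ filter-++ (T? ∘ bit X) (upTo m) _ ⟩
    onesBelow m X ++ filterᵇ (bit X) (map (m +_) (upTo (suc y)))
      ≡⟨ cong (onesBelow m X ++_) (filterᵇ-map (bit X) (m +_) (upTo (suc y))) ⟩
    onesBelow m X ++ map (m +_) (filterᵇ (bit X ∘ (m +_)) (upTo (suc y)))
      ≡⟨ cong₂ (λ l l′ → l ++ map (m +_) l′) (filterᵇ-cong low-digits) (filterᵇ-cong high-digits) ⟩
    onesBelow m x ++ map (m +_) (onesBelow (suc y) y)
      ≡⟨ cong₂ (λ l l′ → l ++ map (m +_) l′) (exps-onesBelow m x<) (exps-onesBelow (suc y) (n<2^[1+n] y)) ⟨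
    exps x ++ map (m +_) (exps y)
      ∎
    where
    open ≡-Reasoning
    X = x + 2 ^ m * y
    low-digits : All (λ i → bit X i ≡ bit x i) (upTo m)
    low-digits = applyUpTo⁺₁ id m (bit-+-low x y {m})
    high-digits : All (λ i → bit X (m + i) ≡ bit y i) (upTo (suc y))
    high-digits = applyUpTo⁺₂ id (suc y) (λ i → bit-+-high x y m i x<)

  -- Φℕ n = − Ψ n / 3 ^ popcount n, see Φℕ-≃/.
  Ψˡ : List ℕ → ℕ
  Ψˡ []      = 0
  Ψˡ (e ∷ l) = 2 ^ e * 3 ^ suc (length l) + Ψˡ l

  Ψˡ-map-+ : ∀ m l → Ψˡ (map (m +_) l) ≡ 2 ^ m * Ψˡ l
  Ψˡ-map-+ m []      = sym (*-zeroʳ (2 ^ m))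
  Ψˡ-map-+ m (e ∷ l) rewrite Ψˡ-map-+ m l | length-map (m +_) l | ^-distribˡ-+-* 2 m e =
    factor (2 ^ m) (2 ^ e) (3 ^ suc (length l)) (Ψˡ l)
    where
    factor : ∀ a b c d → a * b * c + a * d ≡ a * (b * c + d)
    factor = solve-∀

  Ψˡ-++ : ∀ l l′ → Ψˡ (l ++ l′) ≡ 3 ^ length l′ * Ψˡ l + Ψˡ l′
  Ψˡ-++ []      l′ = sym (cong (_+ Ψˡ l′) (*-zeroʳ (3 ^ length l′)))
  Ψˡ-++ (e ∷ l) l′ rewrite Ψˡ-++ l l′ | length-++ l {l′} | ^-distribˡ-+-* 3 (suc (length l)) (length l′) =
    factor (2 ^ e) (3 ^ suc (length l)) (3 ^ length l′) (Ψˡ l) (Ψˡ l′)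
    where
    factor : ∀ a b c d e → a * (b * c) + (c * d + e) ≡ c * (a * b + d) + e
    factor = solve-∀

  Ψ : ℕ → ℕ
  Ψ n = Ψˡ (exps n)

  popcount : ℕ → ℕ
  popcount n = length (exps n)

  Ψ-+ : ∀ {x} m y → x < 2 ^ m → Ψ (x + 2 ^ m * y) ≡ 3 ^ popcount y * Ψ x + 2 ^ m * Ψ y
  Ψ-+ {x} m y x< = begin
    Ψˡ (exps (x + 2 ^ m * y))                                 ≡⟨ cong Ψˡ (exps-+ m y x<) ⟩
    Ψˡ (exps x ++ map (m +_) (exps y))                        ≡⟨ Ψˡ-++ (exps x) _ ⟩
    3 ^ length (map (m +_) (exps y)) * Ψ x + Ψˡ (map (m +_) (exps y))
      ≡⟨ cong₂ (λ k z → 3 ^ k * Ψ x + z) (length-map (m +_) (exps y)) (Ψˡ-map-+ m (exps y)) ⟩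
    3 ^ popcount y * Ψ x + 2 ^ m * Ψ y                        ∎
    where open ≡-Reasoning

  popcount-+ : ∀ {x} m y → x < 2 ^ m → popcount (x + 2 ^ m * y) ≡ popcount x + popcount y
  popcount-+ {x} m y x< = begin
    length (exps (x + 2 ^ m * y))              ≡⟨ cong length (exps-+ m y x<) ⟩
    length (exps x ++ map (m +_) (exps y))     ≡⟨ length-++ (exps x) ⟩
    popcount x + length (map (m +_) (exps y))  ≡⟨ cong (popcount x +_) (length-map (m +_) (exps y)) ⟩
    popcount x + popcount y                    ∎
    where open ≡-Reasoning

module Fractions where

  open Exponents using (Ψˡ; Ψ; popcount)
  open import Data.Nat as ℕ using (ℕ; suc; NonZero)
  import Data.Nat.Properties as ℕ
  open import Data.Nat.Properties using (m^n≢0)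
  import Data.Nat.Tactic.RingSolver as ℕ-Solver
  open import Data.Integer using (ℤ; +_; _*_; _+_; -_)
  open import Data.Integer.GCD using (gcd)
  open import Data.Integer.Properties using (pos-*; pos-+; *-cancelʳ-≡; neg-distribˡ-*)
  open import Data.Integer.Tactic.RingSolver
  open import Data.Rational as ℚ using (ℚ; ↥_; ↧_; ↧ₙ_; mkℚ)
  open import Data.Rational.Properties using (↥-/; ↧-/; ↥-neg; ↧-neg)
  open import Data.List using ([]; _∷_; applyUpTo; zip; length)

  -- a record rather than the bare equation, so that x, n and d can be inferred from a proof
  infix 4 _≃_/_
  record _≃_/_ (x : ℚ) (n : ℤ) (d : ℕ) : Set where
    constructor ≃/-intro
    field cross : ↥ x * + d ≡ n * ↧ x

  /-≃/ : ∀ i n .{{_ : NonZero n}} → (i ℚ./ n) ≃ i / n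
  /-≃/ i n = ≃/-intro (begin
    ↥ x * + n             ≡⟨ cong (↥ x *_) (↧-/ i n) ⟨
    ↥ x * (↧ x * g)       ≡⟨ swap (↥ x) (↧ x) g ⟩
    (↥ x * g) * ↧ x       ≡⟨ cong (_* ↧ x) (↥-/ i n) ⟩
    i * ↧ x               ∎)
    where
    open ≡-Reasoning
    x = i ℚ./ n
    g = gcd i (+ n)
    swap : ∀ a b c → a * (b * c) ≡ (a * c) * b
    swap = solve-∀

  ≃/-resize : ∀ {x A B A′ B′} .{{_ : NonZero B}} → x ≃ A / B → A * + B′ ≡ A′ * + B → x ≃ A′ / B′
  ≃/-resize {x} {A} {B} {A′} {B′} (≃/-intro x≃) cross = ≃/-intro (*-cancelʳ-≡ _ _ (+ B) (begin
    (↥ x * + B′) * + B  ≡⟨ swap (↥ x) (+ B′) (+ B) ⟩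
    (↥ x * + B) * + B′  ≡⟨ cong (_* + B′) x≃ ⟩
    (A * ↧ x) * + B′    ≡⟨ swap A (↧ x) (+ B′) ⟩
    (A * + B′) * ↧ x    ≡⟨ cong (_* ↧ x) cross ⟩
    (A′ * + B) * ↧ x    ≡⟨ swap A′ (+ B) (↧ x) ⟩
    (A′ * ↧ x) * + B    ∎))
    where
    open ≡-Reasoning
    swap : ∀ a b c → (a * b) * c ≡ (a * c) * b
    swap = solve-∀

  +-≃/ : ∀ {x y n d m e} .{{_ : NonZero d}} .{{_ : NonZero e}} →
         x ≃ + n / d → y ≃ + m / e → x ℚ.+ y ≃ + (n ℕ.* e ℕ.+ m ℕ.* d) / (d ℕ.* e)
  +-≃/ {x@(mkℚ _ _ _)} {y@(mkℚ _ _ _)} {n} {d} {m} {e} (≃/-intro x≃) (≃/-intro y≃) =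
    ≃/-resize (/-≃/ A (↧ₙ x ℕ.* ↧ₙ y)) (begin
      A * + (d ℕ.* e)                                      ≡⟨ cong (A *_) (pos-* d e) ⟩
      A * (+ d * + e)                                      ≡⟨ distribute (↥ x) (↧ y) (↥ y) (↧ x) (+ d) (+ e) ⟩
      (↥ x * + d) * (↧ y * + e) + (↥ y * + e) * (↧ x * + d)
        ≡⟨ cong₂ (λ a b → a * (↧ y * + e) + b * (↧ x * + d)) x≃ y≃ ⟩
      (+ n * ↧ x) * (↧ y * + e) + (+ m * ↧ y) * (↧ x * + d) ≡⟨ collect (+ n) (+ m) (↧ x) (↧ y) (+ d) (+ e) ⟩
      (+ n * + e + + m * + d) * (↧ x * ↧ y)
        ≡⟨ cong₂ _*_ (sym (trans (pos-+ (n ℕ.* e) _) (cong₂ _+_ (pos-* n e) (pos-* m d)))) (sym (pos-* (↧ₙ x) (↧ₙ y))) ⟩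
      + (n ℕ.* e ℕ.+ m ℕ.* d) * + (↧ₙ x ℕ.* ↧ₙ y)          ∎)
    where
    open ≡-Reasoning
    A = ↥ x * ↧ y + ↥ y * ↧ x
    distribute : ∀ a b c d e f → (a * b + c * d) * (e * f) ≡ (a * e) * (b * f) + (c * f) * (d * e)
    distribute = solve-∀
    collect : ∀ n m a b e f → (n * a) * (b * f) + (m * b) * (a * e) ≡ (n * f + m * e) * (a * b)
    collect = solve-∀

  neg-≃/ : ∀ {x n d} → x ≃ n / d → ℚ.- x ≃ - n / d
  neg-≃/ {x} {n} {d} (≃/-intro x≃) = ≃/-intro (begin
    ↥ (ℚ.- x) * + d   ≡⟨ cong (_* + d) (↥-neg x) ⟩
    - ↥ x * + d       ≡⟨ neg-distribˡ-* (↥ x) (+ d) ⟨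
    - (↥ x * + d)     ≡⟨ cong -_ x≃ ⟩
    - (n * ↧ x)       ≡⟨ neg-distribˡ-* n (↧ x) ⟩
    - n * ↧ x         ≡⟨ cong (- n *_) (↧-neg x) ⟨
    - n * ↧ (ℚ.- x)   ∎)
    where open ≡-Reasoning

  private
    ΦΣ-cross : ∀ j len e s → (2 ℕ.^ e ℕ.* 3 ℕ.^ (suc j ℕ.+ len) ℕ.+ s ℕ.* 3 ℕ.^ j) ℕ.* 3 ℕ.^ (j ℕ.+ suc len)
                           ≡ (2 ℕ.^ e ℕ.* 3 ℕ.^ suc len ℕ.+ s) ℕ.* (3 ℕ.^ j ℕ.* 3 ℕ.^ (suc j ℕ.+ len))
    ΦΣ-cross j len e s rewrite ℕ.^-distribˡ-+-* 3 j (suc len) | ℕ.^-distribˡ-+-* 3 j len =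
      rearrange (2 ℕ.^ e) (3 ℕ.^ j) (3 ℕ.^ len) s
      where
      rearrange : ∀ a p q s → (a ℕ.* (3 ℕ.* (p ℕ.* q)) ℕ.+ s ℕ.* p) ℕ.* (p ℕ.* (3 ℕ.* q))
                             ≡ (a ℕ.* (3 ℕ.* q) ℕ.+ s) ℕ.* (p ℕ.* (3 ℕ.* (p ℕ.* q)))
      rearrange = ℕ-Solver.solve-∀

  -- for any f ≗ (j +_), since (j +_) ∘ suc is not definitionally (suc j +_)
  ΦΣ-≃/ : ∀ f j l → (∀ i → f i ≡ j ℕ.+ i) →
          ΦΣ (zip (applyUpTo f (length l)) l) ≃ + Ψˡ l / 3 ℕ.^ (j ℕ.+ length l)
  ΦΣ-≃/ f j []      f≗ = ≃/-intro refl
  ΦΣ-≃/ f j (e ∷ l) f≗ rewrite f≗ 0 | ℕ.+-identityʳ j =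
    ≃/-resize {{ℕ.m*n≢0 _ _ {{3^j≢0}} {{E≢0}}}}
      (+-≃/ {{3^j≢0}} {{E≢0}} (/-≃/ (+ (2 ℕ.^ e)) (3 ℕ.^ j) {{3^j≢0}})
            (ΦΣ-≃/ (f ∘ suc) (suc j) l (λ i → trans (f≗ (suc i)) (ℕ.+-suc j i))))
      (trans (sym (pos-* A _)) (trans (cong +_ (ΦΣ-cross j len e (Ψˡ l))) (pos-* (Ψˡ (e ∷ l)) _)))
    where
    len = length l
    E = 3 ℕ.^ (suc j ℕ.+ len)
    A = 2 ℕ.^ e ℕ.* E ℕ.+ Ψˡ l ℕ.* 3 ℕ.^ j
    3^j≢0 = m^n≢0 3 j
    E≢0 = m^n≢0 3 (suc j ℕ.+ len)

  Φℕ-≃/ : ∀ n → Φℕ n ≃ - + Ψ n / 3 ℕ.^ popcount n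
  Φℕ-≃/ n = neg-≃/ (ΦΣ-≃/ (λ i → i) 0 (exps n) (λ i → refl))

module TwoAdicDivisibility where

  open OddPowers
  open import Data.Nat as ℕ using (ℕ; suc; _^_)
  import Data.Nat.Properties as ℕ
  import Data.Nat.Divisibility as ℕ
  open import Data.Integer using (ℤ; +_; _*_; _+_; _-_; -_)
  open import Data.Integer.Properties using (pos-*; pos-+; m-n≡m⊖n; ⊖-≥)
  open import Data.Integer.Divisibility.Signed
  open import Data.Integer.Tactic.RingSolver
  open import Relation.Binary.Definitions using (tri<; tri≈; tri>)

  infix 4 2^_∣_
  2^_∣_ : ℕ → ℤ → Set
  2^ m ∣ z = + (2 ^ m) ∣ z

  2^∣-* : ∀ m z → 2^ m ∣ z * + (2 ^ m)
  2^∣-* m z = divides z refl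

  2^suc∣⇒2^∣ : ∀ m {z} → 2^ suc m ∣ z → 2^ m ∣ z
  2^suc∣⇒2^∣ m = ∣-trans (divides (+ 2) (pos-* 2 (2 ^ m)))

  2^∣-cancel-2^ : ∀ c h z → 2^ (c ℕ.+ h) ∣ + (2 ^ c) * z → 2^ h ∣ z
  2^∣-cancel-2^ c h z 2^∣ = *-cancelˡ-∣ (+ (2 ^ c)) {{ℕ.m^n≢0 2 c}}
    (subst (_∣ + (2 ^ c) * z) (trans (cong +_ (ℕ.^-distribˡ-+-* 2 c h)) (pos-* (2 ^ c) (2 ^ h))) 2^∣)

  2^∣-cancel-odd : ∀ {a} m z → Odd a → 2^ m ∣ + a * z → 2^ m ∣ z
  2^∣-cancel-odd {a} m z odd (divides w az≡) with odd-inverse odd m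
  ... | K , u , aK≡ = divides (+ K * w - z * + u) (begin
      z                                 ≡⟨ expand z (+ u) P ⟩
      z * (+ 1 + + u * P) - z * (+ u * P) ≡⟨ cong (λ t → z * t - z * (+ u * P)) (sym aK≡ℤ) ⟩
      z * (+ a * + K) - z * (+ u * P)   ≡⟨ reorder z (+ a) (+ K) (z * (+ u * P)) ⟩
      + K * (+ a * z) - z * (+ u * P)   ≡⟨ cong (λ t → + K * t - z * (+ u * P)) az≡ ⟩
      + K * (w * P) - z * (+ u * P)     ≡⟨ collect (+ K) w z (+ u) P ⟩
      (+ K * w - z * + u) * P           ∎)
    where
    open ≡-Reasoning
    P = + (2 ^ m)
    aK≡ℤ : + a * + K ≡ + 1 + + u * P
    aK≡ℤ = trans (sym (pos-* a K)) (trans (cong +_ aK≡) (trans (pos-+ 1 _) (cong (λ t → + 1 + t) (pos-* u (2 ^ m)))))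
    expand : ∀ z u p → z ≡ z * (+ 1 + u * p) - z * (u * p)
    expand = solve-∀
    reorder : ∀ z a k t → z * (a * k) - t ≡ k * (a * z) - t
    reorder = solve-∀
    collect : ∀ k w z u p → k * (w * p) - z * (u * p) ≡ (k * w - z * u) * p
    collect = solve-∀

  private
    2^∣-diff-< : ∀ m {y y′} → y′ ℕ.< y → y ℕ.< 2 ^ m → ¬ (2^ m ∣ + y - + y′)
    2^∣-diff-< m {y} {y′} y′<y y< 2^∣ = ℕ.<-irrefl refl (ℕ.<-≤-trans y< (ℕ.≤-trans 2^m≤ (ℕ.m∸n≤m y y′)))
      where
      2^m≤ : 2 ^ m ℕ.≤ y ℕ.∸ y′
      2^m≤ = ℕ.∣⇒≤ {{ℕ.>-nonZero (ℕ.m<n⇒0<n∸m y′<y)}}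
               (∣⇒∣ᵤ (subst (2^ m ∣_) (trans (m-n≡m⊖n y y′) (⊖-≥ (ℕ.<⇒≤ y′<y))) 2^∣))

  2^∣⇒≡ : ∀ m {y y′} → y ℕ.< 2 ^ m → y′ ℕ.< 2 ^ m → 2^ m ∣ + y - + y′ → y ≡ y′
  2^∣⇒≡ m {y} {y′} y< y′< 2^∣ with ℕ.<-cmp y y′
  ... | tri≈ _ y≡y′ _ = y≡y′
  ... | tri> _ _ y′<y = ⊥-elim (2^∣-diff-< m y′<y y< 2^∣)
  ... | tri< y<y′ _ _ = ⊥-elim (2^∣-diff-< m y<y′ y′< (subst (2^ m ∣_) (negate (+ y) (+ y′)) (∣m⇒∣-m 2^∣)))
    where
    negate : ∀ a b → - (a - b) ≡ b - a
    negate = solve-∀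

  ≡+*2^⇒2^∣- : ∀ h {A B} X → A ≡ B ℕ.+ X ℕ.* 2 ^ h → 2^ h ∣ + A - + B
  ≡+*2^⇒2^∣- h {A} {B} X refl = divides (+ X) (begin
    + (B ℕ.+ X ℕ.* 2 ^ h) - + B     ≡⟨ cong (_- + B) (trans (pos-+ B _) (cong (λ t → + B + t) (pos-* X (2 ^ h)))) ⟩
    (+ B + + X * + (2 ^ h)) - + B   ≡⟨ cancel (+ B) (+ X) (+ (2 ^ h)) ⟩
    + X * + (2 ^ h)                 ∎)
    where
    open ≡-Reasoning
    cancel : ∀ b x p → (b + x * p) - b ≡ x * p
    cancel = solve-∀

  odd-shifts-unique : ∀ h {a G w w′ W₁ W₂} → Odd a → w ℕ.< 2 ^ h → w′ ℕ.< 2 ^ h →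
    2^ h ∣ + a * (+ G - + w) + + W₁ → 2^ h ∣ + a * (+ G - + w′) + + W₂ → 2^ h ∣ + W₁ - + W₂ → w ≡ w′
  odd-shifts-unique h {a} {G} {w} {w′} {W₁} {W₂} odd w< w′< 2^∣₁ 2^∣₂ 2^∣W =
    sym (2^∣⇒≡ h w′< w< (2^∣-cancel-odd h _ odd (subst (2^ h ∣_) (cancel (+ a) (+ G) (+ w) (+ w′) (+ W₁) (+ W₂))
      (∣m∣n⇒∣m-n (∣m∣n⇒∣m-n 2^∣₁ 2^∣₂) 2^∣W))))
    where
    cancel : ∀ a g x y u v → ((a * (g - x) + u) - (a * (g - y) + v)) - (u - v) ≡ a * (y - x)
    cancel = solve-∀

module Residues where

  open OddPowers
  open Fractions using (_≃_/_; ≃/-intro)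
  open TwoAdicDivisibility
  open BinaryDigits using (_%2^_; _/2^_; n%2^m<2^m; n≡n%2^m+[n/2^m]*2^m; %2^-unique; %2^-suc)
  open import Data.Nat as ℕ using (ℕ; zero; suc; _^_; z≤n; s≤s; _≡ᵇ_)
  import Data.Nat.Properties as ℕ
  import Data.Nat.Divisibility as ℕ
  open import Data.Nat.Coprimality using (coprime?)
  open import Data.Integer using (ℤ; +_; _*_; _+_; _-_; -_; ∣_∣)
  open import Data.Integer.Properties using (pos-*; pos-+; *-comm; *-assoc; *-identityʳ; +-identityˡ)
  open import Data.Integer.DivMod using (_%ℕ_; _/ℕ_; n%ℕd<d; a≡a%ℕn+[a/ℕn]*n)
  open import Data.Integer.Divisibility.Signed
  open import Data.Integer.Tactic.RingSolver
  open import Data.Rational using (ℚ; ↥_; ↧_; ↧ₙ_; mkℚ)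
  open import Relation.Nullary.Decidable using (recompute)

  least-unique : ∀ n (P : ℕ → Bool) {y} → y ℕ.< n → P y ≡ true →
                 (∀ {y′} → y′ ℕ.< y → P y′ ≡ false) → least n P ≡ y
  least-unique (suc n) P {zero}  _         Py _       rewrite Py = refl
  least-unique (suc n) P {suc y} (s≤s y<n) Py below rewrite below (s≤s z≤n) =
    cong suc (least-unique n (P ∘ suc) y<n Py (λ y′<y → below (s≤s y′<y)))

  odd-↧ : ∀ {x N D} → x ≃ N / D → Odd D → Odd (↧ₙ x)
  odd-↧ {x@(mkℚ _ _ coprime)} {N} {D} (≃/-intro x≃) odd with even⊎odd (↧ₙ x)
  ... | inj₂ odd-↧x = odd-↧x
  ... | inj₁ (s , ↧x≡) = ⊥-elim (ℕ.1+n≢0 {0} (ℕ.suc-injective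
          (recompute (coprime? ∣ ↥ x ∣ (↧ₙ x)) coprime (2∣↥x , ℕ.divides s ↧x≡))))
    where
    2∣D↥x : 2^ 1 ∣ + D * ↥ x
    2∣D↥x = divides (N * + s) (begin
       + D * ↥ x         ≡⟨ *-comm (+ D) (↥ x) ⟩
       ↥ x * + D         ≡⟨ x≃ ⟩
       N * + (↧ₙ x)      ≡⟨ cong (λ t → N * + t) ↧x≡ ⟩
       N * + (s ℕ.* 2)   ≡⟨ cong (N *_) (pos-* s 2) ⟩
       N * (+ s * + 2)   ≡⟨ *-assoc N (+ s) (+ 2) ⟨
       N * + s * + 2     ∎)
      where open ≡-Reasoning
    2∣↥x : 2 ℕ.∣ ∣ ↥ x ∣
    2∣↥x = ∣⇒∣ᵤ (2^∣-cancel-odd 1 (↥ x) odd 2∣D↥x)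

  private
    residueTest : ℕ → ℚ → ℕ → Bool
    residueTest m x y = ((↧ x * + y - ↥ x) %ℕ 2 ^ m) {{ℕ.m^n≢0 2 m}} ≡ᵇ 0

    residueTest-sound : ∀ m x y → residueTest m x y ≡ true → 2^ m ∣ ↧ x * + y - ↥ x
    residueTest-sound m x y test with ((↧ x * + y - ↥ x) %ℕ 2 ^ m) {{ℕ.m^n≢0 2 m}} in r≡
    ... | zero = divides q (begin
        z                   ≡⟨ a≡a%ℕn+[a/ℕn]*n z (2 ^ m) {{ℕ.m^n≢0 2 m}} ⟩
        + r + q * + (2 ^ m) ≡⟨ cong (λ t → + t + q * + (2 ^ m)) r≡ ⟩
        + 0 + q * + (2 ^ m) ≡⟨ +-identityˡ _ ⟩
        q * + (2 ^ m)       ∎)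
      where
      open ≡-Reasoning
      z = ↧ x * + y - ↥ x
      r = (z %ℕ 2 ^ m) {{ℕ.m^n≢0 2 m}}
      q = (z /ℕ 2 ^ m) {{ℕ.m^n≢0 2 m}}

    residueTest-complete : ∀ m x y → 2^ m ∣ ↧ x * + y - ↥ x → residueTest m x y ≡ true
    residueTest-complete m x y 2^∣z = cong (_≡ᵇ 0) (2^∣⇒≡ m (n%ℕd<d z (2 ^ m) {{ℕ.m^n≢0 2 m}}) (ℕ.m^n>0 2 m)
      (subst (2^ m ∣_) z-q*P≡r (∣m∣n⇒∣m-n 2^∣z (2^∣-* m q))))
      where
      open ≡-Reasoning
      z = ↧ x * + y - ↥ x
      r = (z %ℕ 2 ^ m) {{ℕ.m^n≢0 2 m}}
      q = (z /ℕ 2 ^ m) {{ℕ.m^n≢0 2 m}}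
      cancel : ∀ r s → (r + s) - s ≡ r - + 0
      cancel = solve-∀
      z-q*P≡r : z - q * + (2 ^ m) ≡ + r - + 0
      z-q*P≡r = begin
        z - q * + (2 ^ m)                     ≡⟨ cong (_- q * + (2 ^ m)) (a≡a%ℕn+[a/ℕn]*n z (2 ^ m) {{ℕ.m^n≢0 2 m}}) ⟩
        (+ r + q * + (2 ^ m)) - q * + (2 ^ m) ≡⟨ cancel (+ r) (q * + (2 ^ m)) ⟩
        + r - + 0                             ∎

    ≃/-residue-scale : ∀ {x N D} y → x ≃ N / D → + D * (↧ x * + y - ↥ x) ≡ ↧ x * (+ D * + y - N)
    ≃/-residue-scale {x} {N} {D} y (≃/-intro x≃) = begin
      + D * (↧ x * + y - ↥ x)     ≡⟨ expand (+ D) (↧ x) (+ y) (↥ x) ⟩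
      ↧ x * + D * + y - ↥ x * + D ≡⟨ cong (λ t → ↧ x * + D * + y - t) x≃ ⟩
      ↧ x * + D * + y - N * ↧ x   ≡⟨ collect (↧ x) (+ D) (+ y) N ⟩
      ↧ x * (+ D * + y - N)       ∎
      where
      open ≡-Reasoning
      expand : ∀ d e y u → d * (e * y - u) ≡ e * d * y - u * d
      expand = solve-∀
      collect : ∀ e d y n → e * d * y - n * e ≡ e * (d * y - n)
      collect = solve-∀

    residueTest⇒ : ∀ m {x N D} y → x ≃ N / D → Odd D → residueTest m x y ≡ true → 2^ m ∣ + D * + y - N
    residueTest⇒ m {x} {N} {D} y x≃ odd test = 2^∣-cancel-odd m _ (odd-↧ x≃ odd)
      (subst (2^ m ∣_) (≃/-residue-scale y x≃) (∣n⇒∣m*n (+ D) (residueTest-sound m x y test)))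

    ⇒residueTest : ∀ m {x N D} y → x ≃ N / D → Odd D → 2^ m ∣ + D * + y - N → residueTest m x y ≡ true
    ⇒residueTest m {x} y x≃ odd 2^∣ = residueTest-complete m x y (2^∣-cancel-odd m _ odd
      (subst (2^ m ∣_) (sym (≃/-residue-scale y x≃)) (∣n⇒∣m*n (↧ x) 2^∣)))

  residue-unique : ∀ m {x N D y} → x ≃ N / D → Odd D → y ℕ.< 2 ^ m → 2^ m ∣ + D * + y - N → residue m x ≡ y
  residue-unique m {x} {N} {D} {y} x≃ odd y< 2^∣ =
    least-unique (2 ^ m) (residueTest m x) y< (⇒residueTest m y x≃ odd 2^∣) below
    where
    below : ∀ {y′} → y′ ℕ.< y → residueTest m x y′ ≡ false
    below {y′} y′<y with residueTest m x y′ in test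
    ... | false = refl
    ... | true  = ⊥-elim (ℕ.<-irrefl y′≡y y′<y)
      where
      difference : ∀ d a b n → (d * a - n) - (d * b - n) ≡ d * (a - b)
      difference = solve-∀
      y′≡y : y′ ≡ y
      y′≡y = 2^∣⇒≡ m (ℕ.<-trans y′<y y<) y< (2^∣-cancel-odd m _ odd
        (subst (2^ m ∣_) (difference (+ D) (+ y′) (+ y) N) (∣m∣n⇒∣m-n (residueTest⇒ m y′ x≃ odd test) 2^∣)))

  residue-exists : ∀ m N {D} → Odd D → ∃ λ y → y ℕ.< 2 ^ m × 2^ m ∣ + D * + y - N
  residue-exists m N {D} odd with odd-inverse odd m
  ... | K , u , DK≡ = y , n%ℕd<d (+ K * N) (2 ^ m) {{ℕ.m^n≢0 2 m}} , divides (+ u * N - + D * q) (begin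
      + D * + y - N                         ≡⟨ cong (λ t → + D * t - N) y≡ ⟩
      + D * ((+ K * N) - q * P) - N         ≡⟨ expand (+ D) (+ K) N q P ⟩
      (+ D * + K) * N - N - + D * q * P     ≡⟨ cong (λ t → t * N - N - + D * q * P) DK≡ℤ ⟩
      (+ 1 + + u * P) * N - N - + D * q * P ≡⟨ collect (+ u) P N (+ D) q ⟩
      (+ u * N - + D * q) * P               ∎)
    where
    open ≡-Reasoning
    P = + (2 ^ m)
    y = ((+ K * N) %ℕ 2 ^ m) {{ℕ.m^n≢0 2 m}}
    q = ((+ K * N) /ℕ 2 ^ m) {{ℕ.m^n≢0 2 m}}
    cancel : ∀ a b → a ≡ (a + b) - b
    cancel = solve-∀
    y≡ : + y ≡ + K * N - q * P
    y≡ = trans (cancel (+ y) (q * P)) (cong (_- q * P) (sym (a≡a%ℕn+[a/ℕn]*n (+ K * N) (2 ^ m) {{ℕ.m^n≢0 2 m}})))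
    DK≡ℤ : + D * + K ≡ + 1 + + u * P
    DK≡ℤ = trans (sym (pos-* D K)) (trans (cong +_ DK≡) (trans (pos-+ 1 _) (cong (λ t → + 1 + t) (pos-* u (2 ^ m)))))
    expand : ∀ d k n q p → d * (k * n - q * p) - n ≡ (d * k) * n - n - d * q * p
    expand = solve-∀
    collect : ∀ u p n d q → (+ 1 + u * p) * n - n - d * q * p ≡ (u * n - d * q) * p
    collect = solve-∀

  residue-spec : ∀ m {x N D} → x ≃ N / D → Odd D → residue m x ℕ.< 2 ^ m × 2^ m ∣ + D * + residue m x - N
  residue-spec m {x} {N} {D} x≃ odd =
    subst (ℕ._< 2 ^ m) (sym residue≡y) y< , subst (λ r → 2^ m ∣ + D * + r - N) (sym residue≡y) 2^∣
    where
    solution = residue-exists m N odd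
    y = proj₁ solution
    y< = proj₁ (proj₂ solution)
    2^∣ = proj₂ (proj₂ solution)
    residue≡y : residue m x ≡ y
    residue≡y = residue-unique m x≃ odd y< 2^∣

  2^∣-%2^ : ∀ m {D N} y → 2^ m ∣ + D * + y - N → 2^ m ∣ + D * + (y %2^ m) - N
  2^∣-%2^ m {D} {N} y 2^∣ = subst (2^ m ∣_) remove-multiple (∣m∣n⇒∣m-n 2^∣ (2^∣-* m (+ D * + (y /2^ m))))
    where
    open ≡-Reasoning
    cancel : ∀ d a b p n → (d * (a + b * p) - n) - (d * b) * p ≡ d * a - n
    cancel = solve-∀
    remove-multiple : (+ D * + y - N) - (+ D * + (y /2^ m)) * + (2 ^ m) ≡ + D * + (y %2^ m) - N
    remove-multiple = begin
      (+ D * + y - N) - (+ D * + (y /2^ m)) * + (2 ^ m)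
        ≡⟨ cong (λ t → (+ D * t - N) - (+ D * + (y /2^ m)) * + (2 ^ m))
                (trans (cong +_ (n≡n%2^m+[n/2^m]*2^m y m))
                       (trans (pos-+ (y %2^ m) _) (cong (λ t → + (y %2^ m) + t) (pos-* (y /2^ m) (2 ^ m))))) ⟩
      (+ D * (+ (y %2^ m) + + (y /2^ m) * + (2 ^ m)) - N) - (+ D * + (y /2^ m)) * + (2 ^ m)
        ≡⟨ cancel (+ D) (+ (y %2^ m)) (+ (y /2^ m)) (+ (2 ^ m)) N ⟩
      + D * + (y %2^ m) - N ∎

  L-ℚ→ℤ₂ : ∀ {x N D} → x ≃ N / D → Odd D → ∀ m → L m (ℚ→ℤ₂ x) ≡ residue m x
  L-ℚ→ℤ₂ {x} {N} {D} x≃ odd zero = sym (residue-unique 0 x≃ odd (s≤s z≤n) (divides (+ D * + 0 - N) (sym (*-identityʳ _))))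
  L-ℚ→ℤ₂ {x} {N} {D} x≃ odd (suc m) = begin
    L m (ℚ→ℤ₂ x) ℕ.+ toℕ (bit Y m) ℕ.* 2 ^ m
      ≡⟨ cong (ℕ._+ toℕ (bit Y m) ℕ.* 2 ^ m) (trans (L-ℚ→ℤ₂ x≃ odd m) residue-%2^) ⟩
    Y %2^ m ℕ.+ toℕ (bit Y m) ℕ.* 2 ^ m       ≡⟨ %2^-suc Y m ⟨
    Y %2^ suc m                               ≡⟨ %2^-unique Y (suc m) Y 0 (proj₁ Y-spec) (sym (ℕ.+-identityʳ Y)) ⟩
    Y                                         ∎
    where
    open ≡-Reasoning
    Y = residue (suc m) x
    Y-spec = residue-spec (suc m) x≃ odd
    residue-%2^ : residue m x ≡ Y %2^ m
    residue-%2^ = residue-unique m x≃ odd (n%2^m<2^m Y m) (2^∣-%2^ m {D} {N} Y (2^suc∣⇒2^∣ m (proj₂ Y-spec)))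

module Perturbation where

  open BinaryDigits using (L-+; L<2^)
  open OddPowers using (odd-3^)
  open Fractions using (_≃_/_)
  open TwoAdicDivisibility
  open Residues using (residue-spec; L-ℚ→ℤ₂)
  open import Data.Nat as ℕ using (ℕ; _^_)
  import Data.Nat.Properties as ℕ
  open import Data.Integer using (ℤ; +_; _*_; _+_; _-_; -_)
  open import Data.Integer.Properties using (pos-*; pos-+)
  open import Data.Integer.Divisibility.Signed
  open import Data.Integer.Tactic.RingSolver
  open import Data.Rational using (ℚ)

  -- Y = X − 2^c W / 3^(S+e): Y shares the first c digits of X, and its digits above c are those of X
  -- shifted by −W / 3^(S+e).
  module _ {X Y : ℚ} (V S e c W : ℕ) {V′ : ℕ}
           (X≃ : X ≃ - + V / 3 ^ S) (Y≃ : Y ≃ - + V′ / 3 ^ (S ℕ.+ e))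
           (V′≡ : V′ ≡ 3 ^ e ℕ.* V ℕ.+ 2 ^ c ℕ.* W) where

    private
      zX = ℚ→ℤ₂ X
      zY = ℚ→ℤ₂ Y
      A = + (3 ^ S)
      E = + (3 ^ e)
      AE = + (3 ^ (S ℕ.+ e))
      P = + (2 ^ c)

      AE≡ : AE ≡ A * E
      AE≡ = trans (cong +_ (ℕ.^-distribˡ-+-* 3 S e)) (pos-* (3 ^ S) (3 ^ e))

      V′≡ℤ : + V′ ≡ E * + V + P * + W
      V′≡ℤ = trans (cong +_ V′≡) (trans (pos-+ (3 ^ e ℕ.* V) (2 ^ c ℕ.* W)) (cong₂ _+_ (pos-* (3 ^ e) V) (pos-* (2 ^ c) W)))

      L≡residue-X : ∀ m → 2^ m ∣ A * + L m zX - - + V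
      L≡residue-X m rewrite L-ℚ→ℤ₂ X≃ (odd-3^ S) m = proj₂ (residue-spec m X≃ (odd-3^ S))

      L≡residue-Y : ∀ m → 2^ m ∣ AE * + L m zY - - + V′
      L≡residue-Y m rewrite L-ℚ→ℤ₂ Y≃ (odd-3^ (S ℕ.+ e)) m = proj₂ (residue-spec m Y≃ (odd-3^ (S ℕ.+ e)))

    2^∣-L-difference : ∀ m → 2^ m ∣ AE * (+ L m zY - + L m zX) + P * + W
    2^∣-L-difference m = subst (2^ m ∣_) combine (∣m∣n⇒∣m-n (L≡residue-Y m) (∣n⇒∣m*n E (L≡residue-X m)))
      where
      open ≡-Reasoning
      combine′ : ∀ a e y x v p w → (a * e * y - - (e * v + p * w)) - e * (a * x - - v) ≡ (a * e) * (y - x) + p * w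
      combine′ = solve-∀
      combine : (AE * + L m zY - - + V′) - E * (A * + L m zX - - + V) ≡ AE * (+ L m zY - + L m zX) + P * + W
      combine = begin
        (AE * + L m zY - - + V′) - E * (A * + L m zX - - + V)
          ≡⟨ cong₂ (λ s t → (s * + L m zY - - t) - E * (A * + L m zX - - + V)) AE≡ V′≡ℤ ⟩
        (A * E * + L m zY - - (E * + V + P * + W)) - E * (A * + L m zX - - + V)
          ≡⟨ combine′ A E (+ L m zY) (+ L m zX) (+ V) P (+ W) ⟩
        (A * E) * (+ L m zY - + L m zX) + P * + W
          ≡⟨ cong (λ s → s * (+ L m zY - + L m zX) + P * + W) AE≡ ⟨
        AE * (+ L m zY - + L m zX) + P * + W ∎

    low-digits-agree : L c (ℚ→ℤ₂ Y) ≡ L c (ℚ→ℤ₂ X)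
    low-digits-agree = 2^∣⇒≡ c (L<2^ c zY) (L<2^ c zX) (2^∣-cancel-odd c _ (odd-3^ (S ℕ.+ e))
      (subst (2^ c ∣_) (cancel AE (+ L c zY - + L c zX) P (+ W)) (∣m∣n⇒∣m-n (2^∣-L-difference c) (2^∣-* c (+ W)))))
      where
      cancel : ∀ a d p w → a * d + p * w - w * p ≡ a * d
      cancel = solve-∀

    high-digits-shift : ∀ h → 2^ h ∣ AE * (+ L h (R c zY) - + L h (R c zX)) + + W
    high-digits-shift h = 2^∣-cancel-2^ c h _ (subst (2^ (c ℕ.+ h) ∣_) factor-2^c (2^∣-L-difference (c ℕ.+ h)))
      where
      open ≡-Reasoning
      split : ∀ z → + L (c ℕ.+ h) z ≡ + L c z + P * + L h (R c z)
      split z = trans (cong +_ (L-+ c h z)) (trans (pos-+ (L c z) _) (cong (λ t → + L c z + t) (pos-* (2 ^ c) _)))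
      factor : ∀ a l p y x w → a * ((l + p * y) - (l + p * x)) + p * w ≡ p * (a * (y - x) + w)
      factor = solve-∀
      factor-2^c : AE * (+ L (c ℕ.+ h) zY - + L (c ℕ.+ h) zX) + P * + W ≡ P * (AE * (+ L h (R c zY) - + L h (R c zX)) + + W)
      factor-2^c = begin
        AE * (+ L (c ℕ.+ h) zY - + L (c ℕ.+ h) zX) + P * + W
          ≡⟨ cong₂ (λ s t → AE * (s - t) + P * + W) (split zY) (split zX) ⟩
        AE * ((+ L c zY + P * + L h (R c zY)) - (+ L c zX + P * + L h (R c zX))) + P * + W
          ≡⟨ cong (λ s → AE * ((+ s + P * + L h (R c zY)) - (+ L c zX + P * + L h (R c zX))) + P * + W) low-digits-agree ⟩
        AE * ((+ L c zX + P * + L h (R c zY)) - (+ L c zX + P * + L h (R c zX))) + P * + W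
          ≡⟨ factor AE (+ L c zX) P (+ L h (R c zY)) (+ L h (R c zX)) (+ W) ⟩
        P * (AE * (+ L h (R c zY) - + L h (R c zX)) + + W) ∎

module PhiOfNaturals where

  open BinaryDigits using (_%2^_; _/2^_; n%2^m<2^m; n≡n%2^m+[n/2^m]*2^m)
  open OddPowers using (odd-3^)
  open Exponents using (Ψ; popcount; Ψ-+; popcount-+)
  open Fractions using (_≃_/_; Φℕ-≃/)
  open Residues using (L-ℚ→ℤ₂)
  open Perturbation using (low-digits-agree; high-digits-shift)
  open TwoAdicDivisibility using (2^_∣_)
  open import Data.Nat using (suc; _+_; _*_; _^_; _<_)
  open import Data.Nat.Properties using (*-comm)
  import Data.Integer as ℤ

  Φℕ-≃/-+ : ∀ {x} m y → x < 2 ^ m →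
            Φℕ (x + 2 ^ m * y) ≃ ℤ.- ℤ.+ Ψ (x + 2 ^ m * y) / 3 ^ (popcount x + popcount y)
  Φℕ-≃/-+ {x} m y x< = subst (λ s → Φℕ N ≃ ℤ.- ℤ.+ Ψ N / 3 ^ s) (popcount-+ m y x<) (Φℕ-≃/ N)
    where N = x + 2 ^ m * y

  L-Φℕ-+ : ∀ {x} m y → x < 2 ^ m → L m (ℚ→ℤ₂ (Φℕ (x + 2 ^ m * y))) ≡ L m (ℚ→ℤ₂ (Φℕ x))
  L-Φℕ-+ {x} m y x< = low-digits-agree (Ψ x) (popcount x) (popcount y) m (Ψ y) (Φℕ-≃/ x) (Φℕ-≃/-+ m y x<) (Ψ-+ m y x<)

  high-digits-Φℕ-+ : ∀ {x} m y → x < 2 ^ m → ∀ h →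
    2^ h ∣ ℤ.+ (3 ^ popcount (x + 2 ^ m * y))
             ℤ.* (ℤ.+ L h (R m (ℚ→ℤ₂ (Φℕ (x + 2 ^ m * y)))) ℤ.- ℤ.+ L h (R m (ℚ→ℤ₂ (Φℕ x))))
           ℤ.+ ℤ.+ Ψ y
  high-digits-Φℕ-+ {x} m y x< h = subst (λ s → 2^ h ∣ ℤ.+ (3 ^ s) ℤ.* difference ℤ.+ ℤ.+ Ψ y) (sym (popcount-+ m y x<))
    (high-digits-shift (Ψ x) (popcount x) (popcount y) m (Ψ y) (Φℕ-≃/ x) (Φℕ-≃/-+ m y x<) (Ψ-+ m y x<) h)
    where
    difference = ℤ.+ L h (R m (ℚ→ℤ₂ (Φℕ (x + 2 ^ m * y)))) ℤ.- ℤ.+ L h (R m (ℚ→ℤ₂ (Φℕ x)))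

  ℚ→ℤ₂-Φℕ-%2^ : ∀ n j → ℚ→ℤ₂ (Φℕ (n %2^ suc j)) j ≡ ℚ→ℤ₂ (Φℕ n) j
  ℚ→ℤ₂-Φℕ-%2^ n j = cong (λ r → bit r j) (begin
    residue (suc j) (Φℕ low)                      ≡⟨ L-ℚ→ℤ₂ (Φℕ-≃/ low) (odd-3^ (popcount low)) (suc j) ⟨
    L (suc j) (ℚ→ℤ₂ (Φℕ low))                     ≡⟨ L-Φℕ-+ (suc j) (n /2^ suc j) (n%2^m<2^m n (suc j)) ⟨
    L (suc j) (ℚ→ℤ₂ (Φℕ (low + 2 ^ suc j * (n /2^ suc j)))) ≡⟨ cong (λ m → L (suc j) (ℚ→ℤ₂ (Φℕ m))) n≡ ⟨
    L (suc j) (ℚ→ℤ₂ (Φℕ n))                       ≡⟨ L-ℚ→ℤ₂ (Φℕ-≃/ n) (odd-3^ (popcount n)) (suc j) ⟩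
    residue (suc j) (Φℕ n)                        ∎)
    where
    open ≡-Reasoning
    low = n %2^ suc j
    n≡ : n ≡ low + 2 ^ suc j * (n /2^ suc j)
    n≡ = trans (n≡n%2^m+[n/2^m]*2^m n (suc j)) (cong (low +_) (*-comm (n /2^ suc j) (2 ^ suc j)))

module RepeatedBlocks where

  open BinaryDigits using (+2^*<2^+)
  open Exponents using (popcount; popcount-+)
  open import Data.Nat
  open import Data.Nat.Properties
  open import Data.Nat.Tactic.RingSolver

  bbar-suc : ∀ b v t → bbar b v (suc t) ≡ bbar b v t + 2 ^ (t * v) * b
  bbar-suc b v t = begin
    b * (Σ< t (λ i → 2 ^ (v * i)) + 2 ^ (v * t))     ≡⟨ cong (λ e → b * (Σ< t (λ i → 2 ^ (v * i)) + 2 ^ e)) (*-comm v t) ⟩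
    b * (Σ< t (λ i → 2 ^ (v * i)) + 2 ^ (t * v))     ≡⟨ distribute b (Σ< t (λ i → 2 ^ (v * i))) (2 ^ (t * v)) ⟩
    bbar b v t + 2 ^ (t * v) * b                     ∎
    where
    open ≡-Reasoning
    distribute : ∀ b s p → b * (s + p) ≡ b * s + p * b
    distribute = solve-∀

  bbar-+ : ∀ b v d e → bbar b v (d + e) ≡ bbar b v d + 2 ^ (d * v) * bbar b v e
  bbar-+ b v d zero rewrite +-identityʳ d | *-zeroʳ b | *-zeroʳ (2 ^ (d * v)) = sym (+-identityʳ _)
  bbar-+ b v d (suc e) = begin
    bbar b v (d + suc e)
      ≡⟨ cong (bbar b v) (+-suc d e) ⟩
    bbar b v (suc (d + e))
      ≡⟨ bbar-suc b v (d + e) ⟩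
    bbar b v (d + e) + 2 ^ ((d + e) * v) * b
      ≡⟨ cong₂ (λ x y → x + 2 ^ y * b) (bbar-+ b v d e) (*-distribʳ-+ v d e) ⟩
    bbar b v d + 2 ^ (d * v) * bbar b v e + 2 ^ (d * v + e * v) * b
      ≡⟨ cong (λ x → bbar b v d + 2 ^ (d * v) * bbar b v e + x * b) (^-distribˡ-+-* 2 (d * v) (e * v)) ⟩
    bbar b v d + 2 ^ (d * v) * bbar b v e + 2 ^ (d * v) * 2 ^ (e * v) * b
      ≡⟨ factor (bbar b v d) (2 ^ (d * v)) (bbar b v e) (2 ^ (e * v)) b ⟩
    bbar b v d + 2 ^ (d * v) * (bbar b v e + 2 ^ (e * v) * b)
      ≡⟨ cong (λ x → bbar b v d + 2 ^ (d * v) * x) (bbar-suc b v e) ⟨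
    bbar b v d + 2 ^ (d * v) * bbar b v (suc e)
      ∎
    where
    open ≡-Reasoning
    factor : ∀ x p y r b → x + p * y + p * r * b ≡ x + p * (y + r * b)
    factor = solve-∀

  module _ {b v} (b< : b < 2 ^ v) where

    bbar-< : ∀ t → bbar b v t < 2 ^ (t * v)
    bbar-< zero    rewrite *-zeroʳ b = s≤s z≤n
    bbar-< (suc t) = begin-strict
      bbar b v (suc t)                ≡⟨ bbar-suc b v t ⟩
      bbar b v t + 2 ^ (t * v) * b    <⟨ +2^*<2^+ (t * v) v (bbar-< t) b< ⟩
      2 ^ (t * v + v)                 ≡⟨ cong (2 ^_) (+-comm (t * v) v) ⟩
      2 ^ (suc t * v)                 ∎
      where open ≤-Reasoning

    popcount-bbar : ∀ t → popcount (bbar b v t) ≡ t * popcount b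
    popcount-bbar zero    rewrite *-zeroʳ b = refl
    popcount-bbar (suc t) = begin
      popcount (bbar b v (suc t))                 ≡⟨ cong popcount (bbar-suc b v t) ⟩
      popcount (bbar b v t + 2 ^ (t * v) * b)     ≡⟨ popcount-+ (t * v) b (bbar-< t) ⟩
      popcount (bbar b v t) + popcount b          ≡⟨ cong (_+ popcount b) (popcount-bbar t) ⟩
      t * popcount b + popcount b                 ≡⟨ +-comm (t * popcount b) (popcount b) ⟩
      suc t * popcount b                          ∎
      where open ≡-Reasoning

open import Data.Nat using (ℕ; zero; suc; pred; _+_; _*_; _^_; _<_; _≤_; NonZero)
open import Data.Nat.Properties using (*-zeroʳ)

module Periodicity where

  open import Data.Nat.Properties using (≤-trans; m≤m+n; +-identityʳ)
  open import Data.Nat.Tactic.RingSolver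

  periodic-* : ∀ {A : Set} (f : ℕ → A) {u p} → (∀ i → u ≤ i → f (i + p) ≡ f i) →
               ∀ m {i} → u ≤ i → f (i + m * p) ≡ f i
  periodic-* f         periodic zero    {i} u≤i = cong f (+-identityʳ i)
  periodic-* f {u} {p} periodic (suc m) {i} u≤i = begin
    f (i + (p + m * p))   ≡⟨ cong f (rearrange i p (m * p)) ⟩
    f (i + m * p + p)     ≡⟨ periodic (i + m * p) (≤-trans u≤i (m≤m+n i (m * p))) ⟩
    f (i + m * p)         ≡⟨ periodic-* f periodic m u≤i ⟩
    f i                   ∎
    where
    open ≡-Reasoning
    rearrange : ∀ i p r → i + (p + r) ≡ i + r + p
    rearrange = solve-∀

module Truncations (a k b v : ℕ) (a< : a < 2 ^ k) (b< : b < 2 ^ v) {{v≢0 : NonZero v}} where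

  open BinaryDigits
  open Exponents using (Ψ; popcount; Ψ-+)
  open PhiOfNaturals using (high-digits-Φℕ-+; ℚ→ℤ₂-Φℕ-%2^)
  open RepeatedBlocks
  open Periodicity using (periodic-*)
  open OddPowers using (_≡1[mod_]; ^-≡1[mod]; 3^2^H≡1; odd-3^)
  open TwoAdicDivisibility using (2^_∣_; ≡+*2^⇒2^∣-; odd-shifts-unique)
  open import Data.Nat.Properties
  open import Data.Nat.Tactic.RingSolver
  import Data.Integer as ℤ

  q : ℤ₂
  q = aBbar a k b v

  c : ℕ → ℕ
  c t = k + t * v

  n : ℕ → ℕ
  n t = a + 2 ^ k * bbar b v t

  n-+ : ∀ t d → n (t + d) ≡ n t + 2 ^ c t * bbar b v d
  n-+ t d = begin
    a + 2 ^ k * bbar b v (t + d)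
      ≡⟨ cong (λ x → a + 2 ^ k * x) (bbar-+ b v t d) ⟩
    a + 2 ^ k * (bbar b v t + 2 ^ (t * v) * bbar b v d)
      ≡⟨ distribute a (2 ^ k) (bbar b v t) (2 ^ (t * v)) (bbar b v d) ⟩
    n t + 2 ^ k * 2 ^ (t * v) * bbar b v d
      ≡⟨ cong (λ x → n t + x * bbar b v d) (^-distribˡ-+-* 2 k (t * v)) ⟨
    n t + 2 ^ c t * bbar b v d
      ∎
    where
    open ≡-Reasoning
    distribute : ∀ a p x r y → a + p * (x + r * y) ≡ a + p * x + p * r * y
    distribute = solve-∀

  n< : ∀ t → n t < 2 ^ c t
  n< t = +2^*<2^+ k (t * v) a< (bbar-< b< t)

  bit-n-+ : ∀ t d {j} → j < c t → bit (n (t + d)) j ≡ bit (n t) j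
  bit-n-+ t d j< rewrite n-+ t d = bit-+-low (n t) (bbar b v d) j<

  q-digit : ∀ T {j} → j < c T → q j ≡ bit (n T) j
  q-digit T {j} j< = begin
    bit (n (suc j)) j        ≡⟨ bit-n-+ (suc j) T j<c[1+j] ⟨
    bit (n (suc j + T)) j    ≡⟨ cong (λ t → bit (n t) j) (+-comm (suc j) T) ⟩
    bit (n (T + suc j)) j    ≡⟨ bit-n-+ T (suc j) j< ⟩
    bit (n T) j              ∎
    where
    open ≡-Reasoning
    j<c[1+j] : j < c (suc j)
    j<c[1+j] = ≤-trans (m≤m*n (suc j) v) (m≤n+m (suc j * v) k)

  L-q : ∀ T {m} → m ≤ c T → L m q ≡ n T %2^ m
  L-q T {m} m≤ = trans (L-cong m (λ i< → q-digit T (<-≤-trans i< m≤))) (L-fromℕ m (n T))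

  L-q-c : ∀ t → L (c t) q ≡ n t
  L-q-c t = trans (L-q t ≤-refl) (%2^-unique (n t) (c t) (n t) 0 (n< t) (sym (+-identityʳ (n t))))

  Φq-digit : ∀ T {j} → j < c T → Φ q j ≡ ℚ→ℤ₂ (Φℕ (n T)) j
  Φq-digit T {j} j< = trans (cong (λ m → ℚ→ℤ₂ (Φℕ m) j) (L-q T j<)) (ℚ→ℤ₂-Φℕ-%2^ (n T) j)

  Z : ℕ → ℤ₂
  Z t = ℚ→ℤ₂ (Φℕ (n t))

  W : ℕ → ℕ
  W d = Ψ (bbar b v d)

  Z-+-high-digits : ∀ t d h →
    2^ h ∣ ℤ.+ (3 ^ popcount (n (t + d))) ℤ.* (ℤ.+ L h (R (c t) (Z (t + d))) ℤ.- ℤ.+ L h (R (c t) (Z t)))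
           ℤ.+ ℤ.+ W d
  Z-+-high-digits t d h =
    subst (λ N → 2^ h ∣ ℤ.+ (3 ^ popcount N) ℤ.* (ℤ.+ L h (R (c t) (ℚ→ℤ₂ (Φℕ N))) ℤ.- ℤ.+ L h (R (c t) (Z t)))
                       ℤ.+ ℤ.+ W d)
    (sym (n-+ t d)) (high-digits-Φℕ-+ (c t) (bbar b v d) (n< t) h)

  2^∣-W-period : ∀ H → 1 ≤ H → ∀ p → 2^ (H + 2) ∣ ℤ.+ W (p * 2 ^ H + (H + 2)) ℤ.- ℤ.+ W (H + 2)
  2^∣-W-period H H≥1 p = ≡+*2^⇒2^∣- h (w * W h + 2 ^ (h * pred v) * W P) (begin
    W (P + h)                                              ≡⟨ cong W (+-comm P h) ⟩
    Ψ (bbar b v (h + P))                                   ≡⟨ cong Ψ (bbar-+ b v h P) ⟩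
    Ψ (bbar b v h + 2 ^ (h * v) * bbar b v P)              ≡⟨ Ψ-+ (h * v) (bbar b v P) (bbar-< b< h) ⟩
    3 ^ popcount (bbar b v P) * W h + 2 ^ (h * v) * W P    ≡⟨ cong₂ (λ x y → x * W h + y * W P) 3^popcount≡ 2^hv≡ ⟩
    (1 + w * 2 ^ h) * W h + 2 ^ h * 2 ^ (h * pred v) * W P ≡⟨ rearrange w (2 ^ h) (W h) (2 ^ (h * pred v)) (W P) ⟩
    W h + (w * W h + 2 ^ (h * pred v) * W P) * 2 ^ h       ∎)
    where
    open ≡-Reasoning
    h = H + 2
    P = p * 2 ^ H
    β = popcount b
    3^P≡1 : 3 ^ (P * β) ≡1[mod 2 ^ h ]
    3^P≡1 = subst (_≡1[mod 2 ^ h ]) (trans (^-*-assoc 3 (2 ^ H) (p * β)) (cong (3 ^_) (regroup p (2 ^ H) β)))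
                  (^-≡1[mod] (3^2^H≡1 H H≥1) (p * β))
      where
      regroup : ∀ p x b → x * (p * b) ≡ p * x * b
      regroup = solve-∀
    w = proj₁ 3^P≡1
    3^popcount≡ : 3 ^ popcount (bbar b v P) ≡ 1 + w * 2 ^ h
    3^popcount≡ = trans (cong (3 ^_) (popcount-bbar {v = v} b< P)) (proj₂ 3^P≡1)
    2^hv≡ : 2 ^ (h * v) ≡ 2 ^ h * 2 ^ (h * pred v)
    2^hv≡ = begin
      2 ^ (h * v)                ≡⟨ cong (λ x → 2 ^ (h * x)) (suc-pred v) ⟨
      2 ^ (h * suc (pred v))     ≡⟨ cong (2 ^_) (*-suc h (pred v)) ⟩
      2 ^ (h + h * pred v)       ≡⟨ ^-distribˡ-+-* 2 h (h * pred v) ⟩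
      2 ^ h * 2 ^ (h * pred v)   ∎
    rearrange : ∀ w p a r b → (1 + w * p) * a + p * r * b ≡ a + (w * a + r * b) * p
    rearrange = solve-∀

  module _ {u p} (periodic : ∀ i → u ≤ i → Φ q (i + p) ≡ Φ q i) (t : ℕ) (u≤ : u ≤ c t) (H : ℕ) where

    private
      h = H + 2
      t′ = t + p * 2 ^ H
      T = t′ + h

    Z-digits-repeat : L h (R (c t) (Z T)) ≡ L h (R (c t′) (Z T))
    Z-digits-repeat = L-cong h shifted-digit
      where
      c[t′]+i<c[T] : ∀ {i} → i < h → c t′ + i < c T
      c[t′]+i<c[T] {i} i<h = begin-strict
        c t′ + i           <⟨ +-monoʳ-< (c t′) (<-≤-trans i<h (m≤m*n h v)) ⟩
        c t′ + h * v       ≡⟨ regroup k t′ h v ⟨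
        c T                ∎
        where
        open ≤-Reasoning
        regroup : ∀ k t h v → k + (t + h) * v ≡ k + t * v + h * v
        regroup = solve-∀
      c[t]+i<c[T] : ∀ {i} → i < h → c t + i < c T
      c[t]+i<c[T] {i} i<h = ≤-<-trans (+-monoˡ-≤ i (+-monoʳ-≤ k (*-monoˡ-≤ v (m≤m+n t (p * 2 ^ H))))) (c[t′]+i<c[T] i<h)
      shifted-digit : ∀ {i} → i < h → Z T (c t + i) ≡ Z T (c t′ + i)
      shifted-digit {i} i<h = begin
        Z T (c t + i)                 ≡⟨ Φq-digit T (c[t]+i<c[T] i<h) ⟨
        Φ q (c t + i)                 ≡⟨ periodic-* (Φ q) periodic (2 ^ H * v) (≤-trans u≤ (m≤m+n (c t) i)) ⟨
        Φ q (c t + i + 2 ^ H * v * p) ≡⟨ cong (Φ q) (regroup k t v i p (2 ^ H)) ⟩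
        Φ q (c t′ + i)                ≡⟨ Φq-digit T (c[t′]+i<c[T] i<h) ⟩
        Z T (c t′ + i)                ∎
        where
        open ≡-Reasoning
        regroup : ∀ k t v i p x → k + t * v + i + x * v * p ≡ k + (t + p * x) * v + i
        regroup = solve-∀

    Z-high-digits-periodic : 1 ≤ H → L h (R (c t) (Z t)) ≡ L h (R (c t′) (Z t′))
    Z-high-digits-periodic H≥1 =
      odd-shifts-unique h (odd-3^ (popcount (n T))) (L<2^ h (R (c t) (Z t))) (L<2^ h (R (c t′) (Z t′)))
        high₁ high₂ (2^∣-W-period H H≥1 p)
      where
      P = p * 2 ^ H
      high₁ : 2^ h ∣ ℤ.+ (3 ^ popcount (n T)) ℤ.* (ℤ.+ L h (R (c t) (Z T)) ℤ.- ℤ.+ L h (R (c t) (Z t))) ℤ.+ ℤ.+ W (P + h)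
      high₁ = subst (λ T → 2^ h ∣ ℤ.+ (3 ^ popcount (n T)) ℤ.* (ℤ.+ L h (R (c t) (Z T)) ℤ.- ℤ.+ L h (R (c t) (Z t)))
                                ℤ.+ ℤ.+ W (P + h))
                    (sym (+-assoc t P h)) (Z-+-high-digits t (P + h) h)
      high₂ : 2^ h ∣ ℤ.+ (3 ^ popcount (n T)) ℤ.* (ℤ.+ L h (R (c t) (Z T)) ℤ.- ℤ.+ L h (R (c t′) (Z t′))) ℤ.+ ℤ.+ W h
      high₂ = subst (λ G → 2^ h ∣ ℤ.+ (3 ^ popcount (n T)) ℤ.* (ℤ.+ G ℤ.- ℤ.+ L h (R (c t′) (Z t′))) ℤ.+ ℤ.+ W h)
                    (sym Z-digits-repeat) (Z-+-high-digits t′ h h)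


theorem15 : (a k b v : ℕ) → a < 2 ^ k → b < 2 ^ v →
    (u p : ℕ) → (∀ i → u ≤ i → Φ (aBbar a k b v) (i + p) ≡ Φ (aBbar a k b v) i) →
    (t : ℕ) → u ≤ k + t * v →
    (H : ℕ) → 1 ≤ H →
    R (k + t * v) (ℚ→ℤ₂ (Φℕ (L (k + t * v) (aBbar a k b v))))
      ≡[mod2^ H + 2 ]
    R (k + (t + p * 2 ^ H) * v) (ℚ→ℤ₂ (Φℕ (L (k + (t + p * 2 ^ H) * v) (aBbar a k b v))))
theorem15 a k b zero      _  _  u p _        t _  H _   rewrite *-zeroʳ t | *-zeroʳ (t + p * 2 ^ H) = refl
theorem15 a k b v@(suc _) a< b< u p periodic t u≤ H H≥1 = begin
  L (H + 2) (R (c t) (ℚ→ℤ₂ (Φℕ (L (c t) q))))     ≡⟨ cong (λ m → L (H + 2) (R (c t) (ℚ→ℤ₂ (Φℕ m)))) (L-q-c t) ⟩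
  L (H + 2) (R (c t) (Z t))                        ≡⟨ Z-high-digits-periodic periodic t u≤ H H≥1 ⟩
  L (H + 2) (R (c t′) (Z t′))                      ≡⟨ cong (λ m → L (H + 2) (R (c t′) (ℚ→ℤ₂ (Φℕ m)))) (L-q-c t′) ⟨
  L (H + 2) (R (c t′) (ℚ→ℤ₂ (Φℕ (L (c t′) q))))   ∎
  where
  open ≡-Reasoning
  open Truncations a k b v a< b<
  t′ = t + p * 2 ^ H
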